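{- For every permutation $\omega\in S_n$, the relation $\le_{\text{d-braid}}$ on $\mathcal R(\omega)$ is a partial order.
   Context: $S_n$ is generated by $s_i=(i,i+1)$; a reduced word for $\omega$ is a sequence $i_1\ldots i_l$ of minimal length with $\omega=s_{i_1}\cdots s_{i_l}$, and $\mathcal R(\omega)$ is the set of reduced words of $\omega$ (all of length $l=\mathrm{l}(\omega)$). A nonempty word $\beta_1\ldots\beta_l$ is a tower word if $\beta_i=\beta_{i-1}+1$ for all $1<i\le l$; the tower decomposition of a word is its unique factorization $\mathfrak a_1\ldots\mathfrak a_s$ into maximal tower words. For a tower word $\mathfrak a$, $\mathrm{in}(\mathfrak a)$, $\mathrm{fin}(\mathfrak a)$ are its first and last letters and $\widetilde{\mathfrak a}$ is obtained by adding $1$ to each letter. Relation $<_1$: $\alpha<_1\beta$ if $\beta$ is obtained from $\alpha=\alpha_1\ldots\alpha_l$ by swapping $\alpha_i,\alpha_{i+1}$ for some $1\le i<l$ with $\alpha_{i+1}\ge\alpha_i+2$. Relation $<_2$: for $\alpha$ with tower decomposition $\mathfrak a_1\ldots\mathfrak a_s$, $\alpha<_2\beta$ if there is $1\le i<s$ with $\mathrm{in}(\mathfrak a_i)\le\mathrm{in}(\mathfrak a_{i+1})<\mathrm{fin}(\mathfrak a_{i+1})<\mathrm{fin}(\mathfrak a_i)$ and $\beta=\mathfrak a_1\ldots\mathfrak a_{i-1}\widetilde{\mathfrak b_1}\mathfrak a_i\mathfrak b_2\mathfrak a_{i+2}\ldots\mathfrak a_s$ for a tower word $\mathfrak b_1$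 and a possibly empty tower word $\mathfrak b_2$ with $\mathfrak b_1\mathfrak b_2=\mathfrak a_{i+1}$. For $\alpha,\beta\in\mathcal R(\omega)$, $\alpha\le_{\text{d-braid}}\beta$ means either $\alpha=\beta$ or there is a sequence $\gamma^0=\alpha,\gamma^1,\ldots,\gamma^m=\beta$ in $\mathcal R(\omega)$ with $\gamma^i<_1\gamma^{i+1}$ or $\gamma^i<_2\gamma^{i+1}$ for each $0\le i\le m-1$. -}

module Defs where

open import Data.Nat using (ℕ; zero; suc; _+_; _≤_; _<_; _≟_)
open import Data.Fin using (Fin; toℕ)
open import Data.Fin.Permutation using (Permutation′; _⟨$⟩ʳ_)
open import Data.List using (List; []; _∷_; _++_; length; concat; map; head; last)
open import Data.List.Relation.Unary.All using (All)
open import Data.Maybe using (Maybe; just; nothing)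
open import Data.Product using (Σ; ∃; ∃-syntax; _×_; _,_; proj₁)
open import Data.Sum using (_⊎_)
open import Relation.Nullary using (yes; no; ¬_)
open import Relation.Binary.PropositionalEquality using (_≡_)
open import Relation.Binary.Construct.Closure.Transitive using (TransClosure)
open import Relation.Binary.Structures using (IsPartialOrder)

-- Words are lists of natural numbers (letters i stand for s_i = (i, i+1)).
Word : Set
Word = List ℕ

ValidLetter : ℕ → ℕ → Set
ValidLetter n i = (1 ≤ i) × (suc i ≤ n)

ValidWord : ℕ → Word → Set
ValidWord n w = All (ValidLetter n) w

sAct : ℕ → ℕ → ℕ
sAct i k with k ≟ i
... | yes _ = suc i
... | no _ with k ≟ suc i
...   | yes _ = i
...   | no _ = k

evalWord : Word → ℕ → ℕ
evalWord [] k = k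
evalWord (i ∷ w) k = sAct i (evalWord w k)

-- the word w (in the letters of S_n) represents ω ∈ S_n, where ω acts on
-- Fin n = {0,…,n-1}, identified with positions {1,…,n} via k ↦ k + 1
Represents : {n : ℕ} → Permutation′ n → Word → Set
Represents {n} ω w =
  ValidWord n w × ((k : Fin n) → evalWord w (suc (toℕ k)) ≡ suc (toℕ (ω ⟨$⟩ʳ k)))

Reduced : {n : ℕ} → Permutation′ n → Word → Set
Reduced ω w = Represents ω w × ((v : Word) → Represents ω v → length w ≤ length v)

_<₁_ : Word → Word → Set
α <₁ β = ∃[ p ] ∃[ a ] ∃[ b ] ∃[ s ]
  (α ≡ p ++ a ∷ b ∷ s) × (β ≡ p ++ b ∷ a ∷ s) × (a + 2 ≤ b)

-- tower words: nonempty, each letter one more than the previous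
data IsTowerFrom : ℕ → Word → Set where
  tw-[] : ∀ {x} → IsTowerFrom x []
  tw-∷  : ∀ {x w} → IsTowerFrom (suc x) w → IsTowerFrom x (suc x ∷ w)

IsTower : Word → Set
IsTower [] = ¬ (0 ≡ 0)
IsTower (x ∷ w) = IsTowerFrom x w

-- the tower decomposition: factorization into maximal tower words
towers : Word → List Word
towers [] = []
towers (x ∷ w) with towers w
... | [] = (x ∷ []) ∷ []
... | ([] ∷ ts) = (x ∷ []) ∷ [] ∷ ts
... | ((y ∷ t) ∷ ts) with y ≟ suc x
...   | yes _ = (x ∷ y ∷ t) ∷ ts
...   | no _ = (x ∷ []) ∷ (y ∷ t) ∷ ts

_<₂_ : Word → Word → Set
α <₂ β = ∃[ pre ] ∃[ a ] ∃[ b ] ∃[ post ]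
  (towers α ≡ pre ++ a ∷ b ∷ post) ×
  (∃[ ia ] ∃[ fa ] ∃[ ib ] ∃[ fb ]
     (head a ≡ just ia) × (last a ≡ just fa) ×
     (head b ≡ just ib) × (last b ≡ just fb) ×
     (ia ≤ ib) × (ib < fb) × (fb < fa)) ×
  (∃[ b₁ ] ∃[ b₂ ]
     IsTower b₁ × (b₂ ≡ [] ⊎ IsTower b₂) × (b₁ ++ b₂ ≡ b) ×
     (β ≡ concat pre ++ map suc b₁ ++ a ++ b₂ ++ concat post))

DStep : {n : ℕ} → Permutation′ n → Word → Word → Set
DStep ω γ δ = Reduced ω γ × Reduced ω δ × (γ <₁ δ ⊎ γ <₂ δ)

_≤d[_]_ : {n : ℕ} → Word → Permutation′ n → Word → Set
α ≤d[ ω ] β = α ≡ β ⊎ TransClosure (DStep ω) α β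

RW : {n : ℕ} → Permutation′ n → Set
RW ω = Σ Word (Reduced ω)

_≈RW_ : {n : ℕ} {ω : Permutation′ n} → RW ω → RW ω → Set
x ≈RW y = proj₁ x ≡ proj₁ y

dBraidRW : {n : ℕ} (ω : Permutation′ n) → RW ω → RW ω → Set
dBraidRW ω x y = proj₁ x ≤d[ ω ] proj₁ y

DBraidIsPartialOrder : {n : ℕ} (ω : Permutation′ n) → Set
DBraidIsPartialOrder ω = IsPartialOrder (_≈RW_ {ω = ω}) (dBraidRW ω)

-- Both generating relations strictly increase a word in the lexicographic order:
-- <₁ moves the larger letter b forward past a, and <₂ replaces the first letter
-- in(𝔞ᵢ) of the affected block by in(𝔞ᵢ₊₁) + 1 > in(𝔞ᵢ), leaving the prefix
-- untouched. Hence ≤_{d-braid} is contained in the reflexive closure of a strict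
-- order, which forces antisymmetry.
module Submission where

open import Defs
open import Level using (Level)
open import Data.Nat using (ℕ; suc; _<_; s≤s; z<s; _≟_)
open import Data.Nat.Properties using (<-≤-trans; m<m+n)
import Data.Nat.Properties as ℕ
open import Data.Fin.Permutation using (Permutation′)
open import Data.List using ([]; _∷_; _++_; concat)
open import Data.List.Properties using (concat-++)
open import Data.List.Relation.Binary.Lex.Strict using (Lex-<; this; next; <-irreflexive; <-transitive)
open import Data.List.Relation.Binary.Pointwise using (≡⇒Pointwise-≡)
open import Data.Product using (proj₁; _,_)
open import Data.Sum using (_⊎_; inj₁; inj₂)
open import Relation.Nullary using (yes; no; contradiction)
open import Relation.Binary.Core using (Rel; _⇒_)
open import Relation.Binary.Definitions using (Transitive)
open import Relation.Binary.Structures using (IsStrictPartialOrder; IsPartialOrder)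
open import Relation.Binary.PropositionalEquality
  using (_≡_; refl; sym; cong; subst; isEquivalence; resp₂; module ≡-Reasoning)
open import Relation.Binary.Construct.Closure.Transitive using (TransClosure; [_]; _∷_)
import Relation.Binary.Construct.Closure.Transitive as TransClosure
import Relation.Binary.Construct.On as On

module _ {a ℓ : Level} {A : Set a} {_<_ : Rel A ℓ} (<-spo : IsStrictPartialOrder _≡_ _<_)
         {R : Rel A ℓ} (R⇒< : R ⇒ _<_) where

  open IsStrictPartialOrder <-spo using (irrefl) renaming (trans to <-trans)

  TransClosure⇒< : TransClosure R ⇒ _<_
  TransClosure⇒< [ xRy ]      = R⇒< xRy
  TransClosure⇒< (xRy ∷ yR⁺z) = <-trans (R⇒< xRy) (TransClosure⇒< yR⁺z)

  reflTransClosure-isPartialOrder : IsPartialOrder _≡_ (λ x y → x ≡ y ⊎ TransClosure R x y)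
  reflTransClosure-isPartialOrder = record
    { isPreorder = record
      { isEquivalence = isEquivalence
      ; reflexive     = inj₁
      ; trans         = ≤-trans
      }
    ; antisym = antisym
    }
    where
    ≤-trans : Transitive (λ x y → x ≡ y ⊎ TransClosure R x y)
    ≤-trans (inj₁ refl) y≤z         = y≤z
    ≤-trans (inj₂ x<y)  (inj₁ refl) = inj₂ x<y
    ≤-trans (inj₂ x<y)  (inj₂ y<z)  = inj₂ (x<y TransClosure.++ y<z)

    antisym : ∀ {x y} → x ≡ y ⊎ TransClosure R x y → y ≡ x ⊎ TransClosure R y x → x ≡ y
    antisym (inj₁ x≡y) _           = x≡y
    antisym (inj₂ _)   (inj₁ y≡x)  = sym y≡x
    antisym (inj₂ x<y) (inj₂ y<x)  =
      contradiction (<-trans (TransClosure⇒< x<y) (TransClosure⇒< y<x)) (irrefl refl)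

_<lex_ : Rel Word _
_<lex_ = Lex-< _≡_ _<_

<lex-isStrictPartialOrder : IsStrictPartialOrder _≡_ _<lex_
<lex-isStrictPartialOrder = record
  { isEquivalence = isEquivalence
  ; irrefl        = λ eq → <-irreflexive ℕ.<-irrefl (≡⇒Pointwise-≡ eq)
  ; trans         = <-transitive isEquivalence ℕ.<-resp₂-≡ ℕ.<-trans
  ; <-resp-≈      = resp₂ _<lex_
  }

++-<lex : ∀ p {x y : ℕ} {s t} → x < y → (p ++ x ∷ s) <lex (p ++ y ∷ t)
++-<lex []      x<y = this x<y
++-<lex (z ∷ p) x<y = next refl (++-<lex p x<y)

concat-towers : ∀ w → concat (towers w) ≡ w
concat-towers []      = refl
concat-towers (x ∷ w) with towers w | concat-towers w
... | []          | eq = cong (x ∷_) eq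
... | [] ∷ _      | eq = cong (x ∷_) eq
... | (y ∷ _) ∷ _  | eq with y ≟ suc x
...   | yes _ = cong (x ∷_) eq
...   | no  _ = cong (x ∷_) eq

<₁⇒<lex : _<₁_ ⇒ _<lex_
<₁⇒<lex (p , a , b , _ , refl , refl , a+2≤b) = ++-<lex p (<-≤-trans (m<m+n a z<s) a+2≤b)

<₂⇒<lex : _<₂_ ⇒ _<lex_
<₂⇒<lex {α} (pre , x ∷ a , _ , post , towers-α ,
             (_ , _ , _ , _ , refl , _ , refl , _ , x≤y , _) ,
             (y ∷ b₁ , b₂ , _ , _ , refl , refl)) =
  subst (_<lex _) (sym α-blocks) (++-<lex (concat pre) (s≤s x≤y))
  where
  open ≡-Reasoning
  α-blocks : α ≡ concat pre ++ (x ∷ a) ++ (y ∷ b₁ ++ b₂) ++ concat post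
  α-blocks = begin
    α                                               ≡⟨ sym (concat-towers α) ⟩
    concat (towers α)                               ≡⟨ cong concat towers-α ⟩
    concat (pre ++ (x ∷ a) ∷ (y ∷ b₁ ++ b₂) ∷ post) ≡⟨ sym (concat-++ pre _) ⟩
    concat pre ++ (x ∷ a) ++ (y ∷ b₁ ++ b₂) ++ concat post  ∎
<₂⇒<lex (_ , [] , _ , _ , _ , (_ , _ , _ , _ , () , _) , _)
<₂⇒<lex (_ , _ ∷ _ , _ , _ , _ , _ , ([] , _ , not-tower , _)) = contradiction refl not-tower

DStep⇒<lex : ∀ {n} (ω : Permutation′ n) → DStep ω ⇒ _<lex_
DStep⇒<lex ω (_ , _ , inj₁ α<₁β) = <₁⇒<lex α<₁β
DStep⇒<lex ω (_ , _ , inj₂ α<₂β) = <₂⇒<lex α<₂β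

mainTheorem3 : (n : ℕ) (ω : Permutation′ n) → DBraidIsPartialOrder ω
mainTheorem3 n ω =
  On.isPartialOrder proj₁
    (reflTransClosure-isPartialOrder <lex-isStrictPartialOrder (DStep⇒<lex ω))
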